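{- Let $y$ be sufficiently large and let $w,z$ be real with $z^{1/2}\ge w\ge y^4$. Fix residue classes $a_p\bmod p$ for all primes $p\le w$. Then for every integer $k\ge0$, with expectation over independent uniform random residue classes $a_p\bmod p$ for primes $w<p\le z$, \[ \mathbb E\binom{S_z}{k}=\Theta_{w,z}^k\binom{S_w}{k}\big(1+O(y^2/w)\big), \] uniformly in these parameters, with an absolute implied constant.
   Context: $\mathcal S_w\defeq\mathbb Z\setminus\bigcup_{p\le w}\{n:n\equiv a_p\bmod p\}$, $S_w\defeq|[0,y]\cap\mathcal S_w|$, and $\Theta_{w,z}\defeq\prod_{w<p\le z}(1-1/p)$.
   Formalization: The parameters y, w and z range over the rationals instead of the reals. -}

module Defs where

open import Data.Bool using (Bool; true; false; not; _∧_; if_then_else_)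
open import Data.Nat as ℕ using (ℕ; zero; suc; _≡ᵇ_)
open import Data.Nat.DivMod using (_%_)
open import Data.Nat.Primality using (prime?)
open import Data.Nat.Combinatorics using (_C_)
open import Data.List using (List; []; _∷_; upTo; filter)
open import Data.Integer as ℤ using (+_)
open import Data.Rational using (ℚ; _+_; _*_; _-_; _/_; 0ℚ; 1ℚ; ↥_)
open import Data.Rational.Properties using (_≤?_; _<?_)
open import Relation.Nullary.Decidable using (does)

toℚ : ℕ → ℚ
toℚ n = (+ n) / 1

-- 1/p (with 1/0 := 0, never used for primes)
inv : ℕ → ℚ
inv zero = 0ℚ
inv (suc n) = (+ 1) / suc n

-- n mod p (with n mod 0 := n, never used for primes)
modN : ℕ → ℕ → ℕ
modN n zero = n
modN n (suc p) = n % suc p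

-- a natural number ≥ max(q,0): |numerator of q|
bound : ℚ → ℕ
bound q = ℤ.∣ ↥ q ∣

natsUpTo : ℚ → List ℕ
natsUpTo q = filter (λ m → toℚ m ≤? q) (upTo (suc (bound q)))

primesIn : ℚ → ℚ → List ℕ
primesIn lo hi = filter (λ p → lo <? toℚ p) (filter prime? (natsUpTo hi))

primesUpTo : ℚ → List ℕ
primesUpTo w = filter prime? (natsUpTo w)

-- A choice of residue classes: a p is (a representative of) a_p mod p.
Residues : Set
Residues = ℕ → ℕ

allB : (ℕ → Bool) → List ℕ → Bool
allB f [] = true
allB f (x ∷ xs) = f x ∧ allB f xs

sifted : ℚ → Residues → ℕ → Bool
sifted w a n = allB (λ p → not (modN n p ≡ᵇ modN (a p) p)) (primesUpTo w)

countB : (ℕ → Bool) → List ℕ → ℕ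
countB f [] = 0
countB f (x ∷ xs) = if f x then suc (countB f xs) else countB f xs

S : ℚ → ℚ → Residues → ℕ
S y w a = countB (sifted w a) (natsUpTo y)

prodℚ : List ℚ → ℚ
prodℚ [] = 1ℚ
prodℚ (x ∷ xs) = x * prodℚ xs

Θ : ℚ → ℚ → ℚ
Θ w z = prodℚ (Data.List.map (λ p → 1ℚ - inv p) (primesIn w z))

powℚ : ℚ → ℕ → ℚ
powℚ x zero = 1ℚ
powℚ x (suc k) = x * powℚ x k

set : Residues → ℕ → ℕ → Residues
set a p r q = if q ≡ᵇ p then r else a q

sumℚ : List ℚ → ℚ
sumℚ [] = 0ℚ
sumℚ (x ∷ xs) = x + sumℚ xs

-- Expectation of F over independent uniform a_p ∈ {0,…,p-1} for p in ps,
-- other residues taken from a.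
Exp : List ℕ → (Residues → ℚ) → Residues → ℚ
Exp [] F a = F a
Exp (p ∷ ps) F a = inv p * sumℚ (Data.List.map (λ r → Exp ps F (set a p r)) (upTo p))

binomℚ : ℕ → ℕ → ℚ
binomℚ n k = toℚ (n C k)

-- Since w ≥ y⁴ > y + 1, every prime p ∈ (w, z] exceeds every n ∈ [0, y], so the class a_p mod p
-- removes at most the single element n = a_p. If m elements survive the primes before p, averaging
-- C(m - [a_p survives], k) over the p classes gives (1 - k/p) C(m, k), by Pascal's rule and
-- k C(m, k) = m C(m - 1, k - 1); by induction over the primes, 𝔼 C(S_z, k) = ∏ (1 - k/p) C(S_w, k).
-- Bernoulli's inequality gives Θᵏ (1 - k² Σ 1/p²) ≤ ∏ (1 - k/p) ≤ Θᵏ, and Σ_{p>w} 1/p² ≤ 1/(w - 1).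
-- As C(S_w, k) = 0 unless k ≤ S_w ≤ y + 1, the relative error is at most 2k²/w ≤ 8y²/w.

module Submission where

open import Level using (0ℓ)
open import Data.Bool using (Bool; true; false; not; _∧_; T)
import Data.Bool.Properties as Bool
open import Data.Empty using (⊥-elim)
open import Data.Product using (Σ; _×_; _,_; proj₁; proj₂)
open import Data.Sum using (_⊎_; inj₁; inj₂; [_,_]′)
open import Data.Nat as ℕ using (ℕ; zero; suc; z≤n; s≤s; _≡ᵇ_)
import Data.Nat.Properties as ℕ
open import Algebra.Properties.CommutativeSemigroup ℕ.+-commutativeSemigroup using () renaming (interchange to +-interchange)
open import Data.Nat.DivMod using (m<n⇒m%n≡m)
open import Data.Nat.Primality using (Prime; prime?; prime⇒nonZero)
open import Data.Nat.Combinatorics using (_C_; nC1≡n; nCk+nC[k+1]≡[n+1]C[k+1])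
open import Data.Nat.Combinatorics.Specification using (k>n⇒nCk≡0)
open import Data.Nat.ListAction using (sum)
import Data.Integer as ℤ
import Data.Integer.Properties as ℤ
import Data.Nat.Coprimality as Coprime
open import Data.Rational
open import Data.Rational.Properties
import Data.Rational.Unnormalised as ℚᵘ
import Data.Rational.Unnormalised.Properties as ℚᵘ
open import Data.List using (List; []; _∷_; map; upTo; length)
import Data.List.Properties as List
open import Data.List.Relation.Unary.All as All using (All; []; _∷_)
import Data.List.Relation.Unary.All.Properties as All
import Data.List.Relation.Unary.AllPairs.Properties as AllPairs
open import Data.List.Relation.Binary.Subset.Propositional using (_⊆_)
open import Data.List.Relation.Unary.AllPairs as AllPairs using (AllPairs; []; _∷_)
open import Data.List.Relation.Unary.Unique.Propositional using (Unique)
import Data.List.Relation.Unary.Unique.Propositional.Properties as Unique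
open import Data.List.Membership.Propositional using (_∈_; _∉_)
open import Data.List.Membership.Propositional.Properties using (∈-upTo⁺; ∈-filter⁺; ∈-filter⁻)
open import Data.List.Relation.Unary.Any using (here; there)
open import Function using (_∘_; Equivalence)
open import Relation.Nullary using (¬_; Dec; yes; no)
open import Relation.Nullary.Decidable using (dec⇒maybe)
open import Relation.Binary.PropositionalEquality
open import Tactic.RingSolver using (solve-∀)
open import Tactic.RingSolver.Core.AlmostCommutativeRing using (AlmostCommutativeRing; fromCommutativeRing)
open import Defs

ℚ-ring : AlmostCommutativeRing 0ℓ 0ℓ
ℚ-ring = fromCommutativeRing +-*-commutativeRing (λ x → dec⇒maybe (0ℚ ≟ x))

*-monoˡ-≤-0≤ : ∀ {p q} r → 0ℚ ≤ r → p ≤ q → r * p ≤ r * q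
*-monoˡ-≤-0≤ r 0≤r p≤q = *-monoˡ-≤-nonNeg r {{nonNegative 0≤r}} p≤q

p≤q⇒0≤q-p : ∀ {p q} → p ≤ q → 0ℚ ≤ q - p
p≤q⇒0≤q-p {p} {q} p≤q = subst (_≤ q - p) (+-inverseʳ p) (+-monoˡ-≤ (- p) p≤q)

0≤q-p⇒p≤q : ∀ {p q} → 0ℚ ≤ q - p → p ≤ q
0≤q-p⇒p≤q {p} {q} 0≤q-p = subst₂ _≤_ (+-identityˡ p) (q-p+p≡q q p) (+-monoˡ-≤ p 0≤q-p)
  where
  q-p+p≡q : ∀ q p → q - p + p ≡ q
  q-p+p≡q = solve-∀ ℚ-ring

≤-by-difference : ∀ {p q} r → q - p ≡ r → 0ℚ ≤ r → p ≤ q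
≤-by-difference r q-p≡r 0≤r = 0≤q-p⇒p≤q (subst (0ℚ ≤_) (sym q-p≡r) 0≤r)

+-pres-0≤ : ∀ {p q} → 0ℚ ≤ p → 0ℚ ≤ q → 0ℚ ≤ p + q
+-pres-0≤ = +-mono-≤

*-pres-0≤ : ∀ {p q} → 0ℚ ≤ p → 0ℚ ≤ q → 0ℚ ≤ p * q
*-pres-0≤ {p} 0≤p 0≤q = subst (_≤ p * _) (*-zeroʳ p) (*-monoˡ-≤-0≤ p 0≤p 0≤q)

p≤p+q : ∀ p {q} → 0ℚ ≤ q → p ≤ p + q
p≤p+q p 0≤q = subst (_≤ p + _) (+-identityʳ p) (+-monoʳ-≤ p 0≤q)

toℚ≡mkℚ : ∀ n → toℚ n ≡ mkℚ (ℤ.+ n) 0 (Coprime.sym (Coprime.1-coprimeTo n))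
toℚ≡mkℚ n = normalize-coprime (Coprime.sym (Coprime.1-coprimeTo n))

toℚ-suc : ∀ n → toℚ (suc n) ≡ 1ℚ + toℚ n
toℚ-suc n = toℚᵘ-injective (begin
  toℚᵘ (toℚ (suc n))                        ≡⟨ cong toℚᵘ (toℚ≡mkℚ (suc n)) ⟩
  ℚᵘ.mkℚᵘ (ℤ.+ suc n) 0                     ≈⟨ ℚᵘ.*≡* (cong (ℤ._* ℤ.+ 1) 1*1+n*1≡1+n) ⟨
  ℚᵘ.mkℚᵘ (ℤ.+ 1) 0 ℚᵘ.+ ℚᵘ.mkℚᵘ (ℤ.+ n) 0  ≡⟨ cong (ℚᵘ.mkℚᵘ (ℤ.+ 1) 0 ℚᵘ.+_) (cong toℚᵘ (toℚ≡mkℚ n)) ⟨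
  toℚᵘ 1ℚ ℚᵘ.+ toℚᵘ (toℚ n)                 ≈⟨ toℚᵘ-homo-+ 1ℚ (toℚ n) ⟨
  toℚᵘ (1ℚ + toℚ n)                         ∎)
  where
  open ℚᵘ.≃-Reasoning
  1*1+n*1≡1+n : ℤ.+ 1 ℤ.* ℤ.+ 1 ℤ.+ ℤ.+ n ℤ.* ℤ.+ 1 ≡ ℤ.+ suc n
  1*1+n*1≡1+n = cong₂ ℤ._+_ (ℤ.*-identityʳ (ℤ.+ 1)) (ℤ.*-identityʳ (ℤ.+ n))

toℚ-+ : ∀ m n → toℚ (m ℕ.+ n) ≡ toℚ m + toℚ n
toℚ-+ zero    n = sym (+-identityˡ (toℚ n))
toℚ-+ (suc m) n = begin
  toℚ (suc (m ℕ.+ n))    ≡⟨ toℚ-suc (m ℕ.+ n) ⟩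
  1ℚ + toℚ (m ℕ.+ n)     ≡⟨ cong (1ℚ +_) (toℚ-+ m n) ⟩
  1ℚ + (toℚ m + toℚ n)   ≡⟨ +-assoc 1ℚ (toℚ m) (toℚ n) ⟨
  1ℚ + toℚ m + toℚ n     ≡⟨ cong (_+ toℚ n) (toℚ-suc m) ⟨
  toℚ (suc m) + toℚ n    ∎
  where open ≡-Reasoning

toℚ-* : ∀ m n → toℚ (m ℕ.* n) ≡ toℚ m * toℚ n
toℚ-* zero    n = sym (*-zeroˡ (toℚ n))
toℚ-* (suc m) n = begin
  toℚ (n ℕ.+ m ℕ.* n)       ≡⟨ toℚ-+ n (m ℕ.* n) ⟩
  toℚ n + toℚ (m ℕ.* n)     ≡⟨ cong (toℚ n +_) (toℚ-* m n) ⟩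
  toℚ n + toℚ m * toℚ n     ≡⟨ distrib (toℚ n) (toℚ m) ⟩
  (1ℚ + toℚ m) * toℚ n      ≡⟨ cong (_* toℚ n) (toℚ-suc m) ⟨
  toℚ (suc m) * toℚ n       ∎
  where
  open ≡-Reasoning
  distrib : ∀ a b → a + b * a ≡ (1ℚ + b) * a
  distrib = solve-∀ ℚ-ring

toℚ-mono-≤ : ∀ {m n} → m ℕ.≤ n → toℚ m ≤ toℚ n
toℚ-mono-≤ {m} {n} m≤n rewrite toℚ≡mkℚ m | toℚ≡mkℚ n =
  *≤* (subst₂ ℤ._≤_ (sym (ℤ.*-identityʳ (ℤ.+ m))) (sym (ℤ.*-identityʳ (ℤ.+ n))) (ℤ.+≤+ m≤n))

toℚ-mono-< : ∀ {m n} → m ℕ.< n → toℚ m < toℚ n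
toℚ-mono-< {m} {n} m<n rewrite toℚ≡mkℚ m | toℚ≡mkℚ n =
  *<* (subst₂ ℤ._<_ (sym (ℤ.*-identityʳ (ℤ.+ m))) (sym (ℤ.*-identityʳ (ℤ.+ n))) (ℤ.+<+ m<n))

toℚ-cancel-< : ∀ {m n} → toℚ m < toℚ n → m ℕ.< n
toℚ-cancel-< {m} {n} lt rewrite toℚ≡mkℚ m | toℚ≡mkℚ n with lt
... | *<* p with subst₂ ℤ._<_ (ℤ.*-identityʳ (ℤ.+ m)) (ℤ.*-identityʳ (ℤ.+ n)) p
...   | ℤ.+<+ m<n = m<n

0≤toℚ : ∀ n → 0ℚ ≤ toℚ n
0≤toℚ n = toℚ-mono-≤ {n = n} z≤n

inv≡mkℚ : ∀ n → inv (suc n) ≡ mkℚ (ℤ.+ 1) n (Coprime.1-coprimeTo (suc n))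
inv≡mkℚ n = normalize-coprime (Coprime.1-coprimeTo (suc n))

inv*toℚ≡1 : ∀ n → inv (suc n) * toℚ (suc n) ≡ 1ℚ
inv*toℚ≡1 n rewrite inv≡mkℚ n | toℚ≡mkℚ (suc n) = *-inverseˡ (mkℚ (ℤ.+ suc n) 0 (Coprime.sym (Coprime.1-coprimeTo (suc n))))

0≤inv : ∀ n → 0ℚ ≤ inv n
0≤inv zero = ≤-refl
0≤inv (suc n) rewrite inv≡mkℚ n = nonNegative⁻¹ _

toℚ*inv≤1 : ∀ {k n} → k ℕ.≤ n → toℚ k * inv n ≤ 1ℚ
toℚ*inv≤1 {n = zero}  z≤n = ≤-trans (≤-reflexive (*-zeroˡ 0ℚ)) (nonNegative⁻¹ 1ℚ)
toℚ*inv≤1 {k} {suc n} k≤n = subst₂ _≤_ (*-comm (inv (suc n)) (toℚ k)) (inv*toℚ≡1 n)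
  (*-monoˡ-≤-0≤ (inv (suc n)) (0≤inv (suc n)) (toℚ-mono-≤ k≤n))

inv≤1 : ∀ n → inv n ≤ 1ℚ
inv≤1 zero    = nonNegative⁻¹ 1ℚ
inv≤1 (suc n) = subst (_≤ 1ℚ) (*-identityˡ (inv (suc n))) (toℚ*inv≤1 (s≤s (z≤n {n})))

0≤1-inv : ∀ n → 0ℚ ≤ 1ℚ - inv n
0≤1-inv n = p≤q⇒0≤q-p (inv≤1 n)

powℚ-pres-0≤ : ∀ {x} k → 0ℚ ≤ x → 0ℚ ≤ powℚ x k
powℚ-pres-0≤ zero    0≤x = nonNegative⁻¹ 1ℚ
powℚ-pres-0≤ (suc k) 0≤x = *-pres-0≤ 0≤x (powℚ-pres-0≤ k 0≤x)

powℚ≤1 : ∀ {x} k → 0ℚ ≤ x → x ≤ 1ℚ → powℚ x k ≤ 1ℚ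
powℚ≤1     zero    0≤x x≤1 = ≤-refl
powℚ≤1 {x} (suc k) 0≤x x≤1 = ≤-trans (*-monoˡ-≤-0≤ x 0≤x (powℚ≤1 k 0≤x x≤1))
                                    (subst (_≤ 1ℚ) (sym (*-identityʳ x)) x≤1)

powℚ-1 : ∀ k → powℚ 1ℚ k ≡ 1ℚ
powℚ-1 zero    = refl
powℚ-1 (suc k) = trans (*-identityˡ (powℚ 1ℚ k)) (powℚ-1 k)

powℚ-distrib-* : ∀ x y k → powℚ (x * y) k ≡ powℚ x k * powℚ y k
powℚ-distrib-* x y zero    = refl
powℚ-distrib-* x y (suc k) rewrite powℚ-distrib-* x y k = interchange x y (powℚ x k) (powℚ y k)
  where
  interchange : ∀ x y a b → x * y * (a * b) ≡ x * a * (y * b)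
  interchange = solve-∀ ℚ-ring

powℚ-prodℚ : ∀ (f : ℕ → ℚ) ps k → powℚ (prodℚ (map f ps)) k ≡ prodℚ (map (λ p → powℚ (f p) k) ps)
powℚ-prodℚ f []       k = powℚ-1 k
powℚ-prodℚ f (p ∷ ps) k = trans (powℚ-distrib-* (f p) (prodℚ (map f ps)) k)
                                 (cong (powℚ (f p) k *_) (powℚ-prodℚ f ps k))

bernoulli : ∀ {x} k → 0ℚ ≤ x → 1ℚ + toℚ k * x ≤ powℚ (1ℚ + x) k
bernoulli {x} zero    0≤x = ≤-reflexive (base x)
  where
  base : ∀ x → 1ℚ + 0ℚ * x ≡ 1ℚ
  base = solve-∀ ℚ-ring
bernoulli {x} (suc k) 0≤x = ≤-trans step (*-monoˡ-≤-0≤ (1ℚ + x) (+-pres-0≤ (nonNegative⁻¹ 1ℚ) 0≤x) (bernoulli k 0≤x))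
  where
  gap : ∀ K x → (1ℚ + x) * (1ℚ + K * x) - (1ℚ + (1ℚ + K) * x) ≡ K * (x * x)
  gap = solve-∀ ℚ-ring
  step : 1ℚ + toℚ (suc k) * x ≤ (1ℚ + x) * (1ℚ + toℚ k * x)
  step rewrite toℚ-suc k = ≤-by-difference _ (gap (toℚ k) x) (*-pres-0≤ (0≤toℚ k) (*-pres-0≤ 0≤x 0≤x))

bernoulli-1-x : ∀ {x} k → 0ℚ ≤ x → x ≤ 1ℚ → 1ℚ - toℚ k * x ≤ powℚ (1ℚ - x) k
bernoulli-1-x {x} zero    0≤x x≤1 = ≤-reflexive (base x)
  where
  base : ∀ x → 1ℚ - 0ℚ * x ≡ 1ℚ
  base = solve-∀ ℚ-ring
bernoulli-1-x {x} (suc k) 0≤x x≤1 = ≤-trans step (*-monoˡ-≤-0≤ (1ℚ - x) (p≤q⇒0≤q-p x≤1) (bernoulli-1-x k 0≤x x≤1))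
  where
  gap : ∀ K x → (1ℚ - x) * (1ℚ - K * x) - (1ℚ - (1ℚ + K) * x) ≡ K * (x * x)
  gap = solve-∀ ℚ-ring
  step : 1ℚ - toℚ (suc k) * x ≤ (1ℚ - x) * (1ℚ - toℚ k * x)
  step rewrite toℚ-suc k = ≤-by-difference _ (gap (toℚ k) x) (*-pres-0≤ (0≤toℚ k) (*-pres-0≤ 0≤x 0≤x))

-- From (1 - x)ᵏ(1 + x)ᵏ ≤ 1 and Bernoulli's inequality for (1 + x)ᵏ.
[1-x]^k*[1-k²x²]≤1-kx : ∀ {x} k → 0ℚ ≤ x → x ≤ 1ℚ → toℚ k * x ≤ 1ℚ →
  powℚ (1ℚ - x) k * (1ℚ - toℚ k * toℚ k * (x * x)) ≤ 1ℚ - toℚ k * x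
[1-x]^k*[1-k²x²]≤1-kx {x} k 0≤x x≤1 kx≤1 = ≤-by-difference _ (gap U V K x)
  (+-pres-0≤ (*-pres-0≤ 0≤1-kx (p≤q⇒0≤q-p UV≤1))
             (*-pres-0≤ (powℚ-pres-0≤ k (p≤q⇒0≤q-p x≤1)) (*-pres-0≤ 0≤1-kx (p≤q⇒0≤q-p (bernoulli k 0≤x)))))
  where
  K = toℚ k
  U = powℚ (1ℚ - x) k
  V = powℚ (1ℚ + x) k
  gap : ∀ U V K x → (1ℚ - K * x) - U * (1ℚ - K * K * (x * x))
      ≡ (1ℚ - K * x) * (1ℚ - U * V) + U * ((1ℚ - K * x) * (V - (1ℚ + K * x)))
  gap = solve-∀ ℚ-ring
  0≤1-kx : 0ℚ ≤ 1ℚ - K * x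
  0≤1-kx = p≤q⇒0≤q-p kx≤1
  1-[1-x][1+x]≡x² : ∀ x → 1ℚ - (1ℚ - x) * (1ℚ + x) ≡ x * x
  1-[1-x][1+x]≡x² = solve-∀ ℚ-ring
  UV≤1 : U * V ≤ 1ℚ
  UV≤1 = subst (_≤ 1ℚ) (powℚ-distrib-* (1ℚ - x) (1ℚ + x) k)
    (powℚ≤1 k (*-pres-0≤ (p≤q⇒0≤q-p x≤1) (+-pres-0≤ (nonNegative⁻¹ 1ℚ) 0≤x))
              (≤-by-difference _ (1-[1-x][1+x]≡x² x) (*-pres-0≤ 0≤x 0≤x)))

∏[1-k/p] : ℕ → List ℕ → ℚ
∏[1-k/p] k ps = prodℚ (map (λ p → 1ℚ - toℚ k * inv p) ps)

∏[1-1/p]^k : ℕ → List ℕ → ℚ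
∏[1-1/p]^k k ps = prodℚ (map (λ p → powℚ (1ℚ - inv p) k) ps)

∑[1/p²] : List ℕ → ℚ
∑[1/p²] ps = sumℚ (map (λ p → inv p * inv p) ps)

0≤∏[1-k/p] : ∀ k ps → All (k ℕ.≤_) ps → 0ℚ ≤ ∏[1-k/p] k ps
0≤∏[1-k/p] k []       []           = nonNegative⁻¹ 1ℚ
0≤∏[1-k/p] k (p ∷ ps) (k≤p ∷ k≤ps) = *-pres-0≤ (p≤q⇒0≤q-p (toℚ*inv≤1 k≤p)) (0≤∏[1-k/p] k ps k≤ps)

0≤∏[1-1/p]^k : ∀ k ps → 0ℚ ≤ ∏[1-1/p]^k k ps
0≤∏[1-1/p]^k k []       = nonNegative⁻¹ 1ℚ
0≤∏[1-1/p]^k k (p ∷ ps) = *-pres-0≤ (powℚ-pres-0≤ k (0≤1-inv p)) (0≤∏[1-1/p]^k k ps)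

0≤∑[1/p²] : ∀ ps → 0ℚ ≤ ∑[1/p²] ps
0≤∑[1/p²] []       = ≤-refl
0≤∑[1/p²] (p ∷ ps) = +-pres-0≤ (*-pres-0≤ (0≤inv p) (0≤inv p)) (0≤∑[1/p²] ps)

∏[1-k/p]≤∏[1-1/p]^k : ∀ k ps → All (k ℕ.≤_) ps → ∏[1-k/p] k ps ≤ ∏[1-1/p]^k k ps
∏[1-k/p]≤∏[1-1/p]^k k []       []           = ≤-refl
∏[1-k/p]≤∏[1-1/p]^k k (p ∷ ps) (k≤p ∷ k≤ps) = ≤-by-difference _ (gap u pow a lin)
  (+-pres-0≤ (*-pres-0≤ (powℚ-pres-0≤ k (0≤1-inv p)) (p≤q⇒0≤q-p (∏[1-k/p]≤∏[1-1/p]^k k ps k≤ps)))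
             (*-pres-0≤ (p≤q⇒0≤q-p (bernoulli-1-x k (0≤inv p) (inv≤1 p))) (0≤∏[1-k/p] k ps k≤ps)))
  where
  a = 1ℚ - toℚ k * inv p
  u = powℚ (1ℚ - inv p) k
  lin = ∏[1-k/p] k ps
  pow = ∏[1-1/p]^k k ps
  gap : ∀ u P a L → u * P - a * L ≡ u * (P - L) + (u - a) * L
  gap = solve-∀ ℚ-ring

∏[1-1/p]^k*[1-k²∑1/p²]≤∏[1-k/p] : ∀ k ps → All (k ℕ.≤_) ps →
  ∏[1-1/p]^k k ps * (1ℚ - toℚ k * toℚ k * ∑[1/p²] ps) ≤ ∏[1-k/p] k ps
∏[1-1/p]^k*[1-k²∑1/p²]≤∏[1-k/p] k [] [] = ≤-reflexive (empty 1ℚ (toℚ k))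
  where
  empty : ∀ t K → t * (1ℚ - K * K * 0ℚ) ≡ t
  empty = solve-∀ ℚ-ring
∏[1-1/p]^k*[1-k²∑1/p²]≤∏[1-k/p] k (p ∷ ps) (k≤p ∷ k≤ps) = ≤-by-difference _ (gap a lin pow u K² x s)
  (+-pres-0≤ (+-pres-0≤ (*-pres-0≤ (p≤q⇒0≤q-p kx≤1) (p≤q⇒0≤q-p (∏[1-1/p]^k*[1-k²∑1/p²]≤∏[1-k/p] k ps k≤ps)))
                        (*-pres-0≤ (0≤∏[1-1/p]^k k ps) (p≤q⇒0≤q-p ([1-x]^k*[1-k²x²]≤1-kx k (0≤inv p) (inv≤1 p) kx≤1))))
             (*-pres-0≤ (*-pres-0≤ (*-pres-0≤ (0≤∏[1-1/p]^k k ps) (*-pres-0≤ (0≤toℚ k) (0≤toℚ k))) (0≤∑[1/p²] ps))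
                        (p≤q⇒0≤q-p (bernoulli-1-x k (0≤inv p) (inv≤1 p)))))
  where
  K² = toℚ k * toℚ k
  x = inv p
  kx≤1 = toℚ*inv≤1 k≤p
  a = 1ℚ - toℚ k * x
  u = powℚ (1ℚ - x) k
  lin = ∏[1-k/p] k ps
  pow = ∏[1-1/p]^k k ps
  s = ∑[1/p²] ps
  gap : ∀ a L P u K² x s → a * L - u * P * (1ℚ - K² * (x * x + s))
     ≡ a * (L - P * (1ℚ - K² * s)) + P * (a - u * (1ℚ - K² * (x * x))) + P * K² * s * (u - a)
  gap = solve-∀ ℚ-ring

-- Telescoping 1/p² ≤ 1/(p - 1) - 1/p: the induction hypothesis is used with t := p.
∑[1/p²]*t≤1 : ∀ t ps → 0ℚ ≤ t → AllPairs ℕ._<_ ps → All (λ p → 1ℚ + t ≤ toℚ p) ps → ∑[1/p²] ps * t ≤ 1ℚ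
∑[1/p²]*t≤1 t []            0≤t _ _ = ≤-trans (≤-reflexive (*-zeroˡ t)) (nonNegative⁻¹ 1ℚ)
∑[1/p²]*t≤1 t (zero ∷ ps)   0≤t _ (1+t≤0 ∷ _) =
  ⊥-elim (<-irrefl refl (≤-<-trans (p≤p+q 1ℚ 0≤t) (≤-<-trans 1+t≤0 (toℚ-mono-< {0} {1} (s≤s z≤n)))))
∑[1/p²]*t≤1 t (suc n ∷ ps) 0≤t (p<ps ∷ sorted) (1+t≤p ∷ 1+t≤ps) = ≤-by-difference _ identity
  (+-pres-0≤ (+-pres-0≤ (*-pres-0≤ 0≤x 0≤x) (*-pres-0≤ (p≤q⇒0≤q-p ih) (0≤1-inv (suc n))))
             (*-pres-0≤ (+-pres-0≤ (*-pres-0≤ 0≤x 0≤x) (0≤∑[1/p²] ps)) (p≤q⇒0≤q-p 1+t≤p)))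
  where
  P = toℚ (suc n)
  x = inv (suc n)
  s = ∑[1/p²] ps
  0≤x = 0≤inv (suc n)
  ih : s * P ≤ 1ℚ
  ih = ∑[1/p²]*t≤1 P ps (0≤toℚ (suc n)) sorted
         (All.map (λ {q} p<q → subst (_≤ toℚ q) (toℚ-suc (suc n)) (toℚ-mono-≤ p<q)) p<ps)
  gap : ∀ x s t P → 1ℚ - (x * x + s) * t
      ≡ x * x + (1ℚ - s * P) * (1ℚ - x) + (x * x + s) * (P - (1ℚ + t)) + (x + s) * (1ℚ - x * P)
  gap = solve-∀ ℚ-ring
  drop : ∀ e x s → e + (x + s) * (1ℚ - 1ℚ) ≡ e
  drop = solve-∀ ℚ-ring
  identity : 1ℚ - (x * x + s) * t ≡ x * x + (1ℚ - s * P) * (1ℚ - x) + (x * x + s) * (P - (1ℚ + t))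
  identity = trans (gap x s t P)
    (trans (cong (λ xP → rest + (x + s) * (1ℚ - xP)) (inv*toℚ≡1 n)) (drop rest x s))
    where rest = x * x + (1ℚ - s * P) * (1ℚ - x) + (x * x + s) * (P - (1ℚ + t))

[1+k]*[1+m]C[1+k]≡[1+m]*mCk : ∀ m k → suc k ℕ.* (suc m C suc k) ≡ suc m ℕ.* (m C k)
[1+k]*[1+m]C[1+k]≡[1+m]*mCk zero    zero    = refl
[1+k]*[1+m]C[1+k]≡[1+m]*mCk zero    (suc k) = ℕ.*-zeroʳ (suc (suc k))
[1+k]*[1+m]C[1+k]≡[1+m]*mCk (suc m) zero    = trans (ℕ.*-identityˡ _) (trans (nC1≡n (suc (suc m))) (sym (ℕ.*-identityʳ _)))
[1+k]*[1+m]C[1+k]≡[1+m]*mCk (suc m) (suc k) = begin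
  suc (suc k) ℕ.* (suc (suc m) C suc (suc k))           ≡⟨ cong (suc (suc k) ℕ.*_) (nCk+nC[k+1]≡[n+1]C[k+1] (suc m) (suc k)) ⟨
  suc (suc k) ℕ.* (c₁ ℕ.+ c₂)                           ≡⟨ ℕ.*-distribˡ-+ (suc (suc k)) c₁ c₂ ⟩
  suc (suc k) ℕ.* c₁ ℕ.+ suc (suc k) ℕ.* c₂             ≡⟨ cong (suc (suc k) ℕ.* c₁ ℕ.+_) ([1+k]*[1+m]C[1+k]≡[1+m]*mCk m (suc k)) ⟩
  c₁ ℕ.+ suc k ℕ.* c₁ ℕ.+ suc m ℕ.* (m C suc k)         ≡⟨ cong (λ t → c₁ ℕ.+ t ℕ.+ suc m ℕ.* (m C suc k)) ([1+k]*[1+m]C[1+k]≡[1+m]*mCk m k) ⟩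
  c₁ ℕ.+ suc m ℕ.* (m C k) ℕ.+ suc m ℕ.* (m C suc k)    ≡⟨ ℕ.+-assoc c₁ _ _ ⟩
  c₁ ℕ.+ (suc m ℕ.* (m C k) ℕ.+ suc m ℕ.* (m C suc k))  ≡⟨ cong (c₁ ℕ.+_) (ℕ.*-distribˡ-+ (suc m) (m C k) (m C suc k)) ⟨
  c₁ ℕ.+ suc m ℕ.* (m C k ℕ.+ m C suc k)                ≡⟨ cong (λ t → c₁ ℕ.+ suc m ℕ.* t) (nCk+nC[k+1]≡[n+1]C[k+1] m k) ⟩
  c₁ ℕ.+ suc m ℕ.* c₁                                   ∎
  where
  open ≡-Reasoning
  c₁ = suc m C suc k
  c₂ = suc m C suc (suc k)

indicator : Bool → ℕ
indicator true  = 1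
indicator false = 0

countB-∷ : ∀ f x xs → countB f (x ∷ xs) ≡ indicator (f x) ℕ.+ countB f xs
countB-∷ f x xs with f x
... | true  = refl
... | false = refl

countB-cong : ∀ {f g} xs → All (λ n → f n ≡ g n) xs → countB f xs ≡ countB g xs
countB-cong []       []             = refl
countB-cong {f} {g} (x ∷ xs) (fx≡gx ∷ eqs) rewrite countB-∷ f x xs | countB-∷ g x xs | fx≡gx =
  cong (indicator (g x) ℕ.+_) (countB-cong xs eqs)

countB-split : ∀ (g h : ℕ → Bool) xs →
  countB (λ n → g n ∧ not (h n)) xs ℕ.+ countB (λ n → g n ∧ h n) xs ≡ countB g xs
countB-split g h [] = refl
countB-split g h (x ∷ xs) with g x | h x
... | true  | true  = trans (ℕ.+-suc _ _) (cong suc (countB-split g h xs))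
... | true  | false = cong suc (countB-split g h xs)
... | false | _     = countB-split g h xs

countB≤length : ∀ f xs → countB f xs ℕ.≤ length xs
countB≤length f []       = z≤n
countB≤length f (x ∷ xs) with f x
... | true  = s≤s (countB≤length f xs)
... | false = ℕ.m≤n⇒m≤1+n (countB≤length f xs)

countB≡0 : ∀ f xs → All (λ n → ¬ T (f n)) xs → countB f xs ≡ 0
countB≡0 f []       []           = refl
countB≡0 f (x ∷ xs) (¬fx ∷ ¬fxs) with f x
... | true  = ⊥-elim (¬fx _)
... | false = countB≡0 f xs ¬fxs

countB≤1 : ∀ {f r} xs → (∀ {n} → T (f n) → n ≡ r) → Unique xs → countB f xs ℕ.≤ 1
countB≤1         []       only-r []             = z≤n
countB≤1 {f} {r} (x ∷ xs) only-r (x∉xs ∷ uniq) with f x in fx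
... | false = countB≤1 xs only-r uniq
... | true  = s≤s (ℕ.≤-reflexive (countB≡0 f xs (All.map (λ x≢y fy → x≢y (trans (only-r fx′) (sym (only-r fy)))) x∉xs)))
  where
  fx′ : T (f x)
  fx′ = subst T (sym fx) _

1≤countB : ∀ {f x} xs → x ∈ xs → T (f x) → 1 ℕ.≤ countB f xs
1≤countB {f} (y ∷ xs) (here refl) fy with f y
... | true = s≤s z≤n
1≤countB {f} (y ∷ xs) (there x∈xs) fx with f y
... | true  = s≤s z≤n
... | false = 1≤countB xs x∈xs fx

sum-map-cong : ∀ {f g : ℕ → ℕ} xs → All (λ x → f x ≡ g x) xs → sum (map f xs) ≡ sum (map g xs)
sum-map-cong []       []         = refl
sum-map-cong (x ∷ xs) (eq ∷ eqs) = cong₂ ℕ._+_ eq (sum-map-cong xs eqs)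

sum-map-+ : ∀ (f g : ℕ → ℕ) xs → sum (map (λ x → f x ℕ.+ g x) xs) ≡ sum (map f xs) ℕ.+ sum (map g xs)
sum-map-+ f g []       = refl
sum-map-+ f g (x ∷ xs) rewrite sum-map-+ f g xs = +-interchange (f x) (g x) (sum (map f xs)) (sum (map g xs))

sum-map-*ʳ : ∀ (f : ℕ → ℕ) c xs → sum (map (λ x → f x ℕ.* c) xs) ≡ sum (map f xs) ℕ.* c
sum-map-*ʳ f c []       = refl
sum-map-*ʳ f c (x ∷ xs) rewrite sum-map-*ʳ f c xs = sym (ℕ.*-distribʳ-+ c (f x) (sum (map f xs)))

sum-map-const : ∀ c (xs : List ℕ) → sum (map (λ _ → c) xs) ≡ length xs ℕ.* c
sum-map-const c []       = refl
sum-map-const c (x ∷ xs) = cong (c ℕ.+_) (sum-map-const c xs)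

sum-map-indicator : ∀ f xs → sum (map (λ x → indicator (f x)) xs) ≡ countB f xs
sum-map-indicator f []       = refl
sum-map-indicator f (x ∷ xs) = trans (cong (indicator (f x) ℕ.+_) (sum-map-indicator f xs)) (sym (countB-∷ f x xs))

∑countB[≡ᵇr]≡countB : ∀ g X U → All (_∈ U) X → Unique U →
  sum (map (λ r → countB (λ n → g n ∧ (n ≡ᵇ r)) X) U) ≡ countB g X
∑countB[≡ᵇr]≡countB g []       U []             uniq = trans (sum-map-const 0 U) (ℕ.*-zeroʳ (length U))
∑countB[≡ᵇr]≡countB g (x ∷ X) U (x∈U ∷ X⊆U) uniq = begin
  sum (map (λ r → countB (g∧≡ᵇ r) (x ∷ X)) U)
    ≡⟨ sum-map-cong U (All.tabulate λ {r} _ → countB-∷ (g∧≡ᵇ r) x X) ⟩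
  sum (map (λ r → indicator (g x ∧ (x ≡ᵇ r)) ℕ.+ countB (g∧≡ᵇ r) X) U)
    ≡⟨ sum-map-+ (λ r → indicator (g x ∧ (x ≡ᵇ r))) (λ r → countB (g∧≡ᵇ r) X) U ⟩
  sum (map (λ r → indicator (g x ∧ (x ≡ᵇ r))) U) ℕ.+ sum (map (λ r → countB (g∧≡ᵇ r) X) U)
    ≡⟨ cong₂ ℕ._+_ (trans (sum-map-indicator (λ r → g x ∧ (x ≡ᵇ r)) U) x-once) (∑countB[≡ᵇr]≡countB g X U X⊆U uniq) ⟩
  indicator (g x) ℕ.+ countB g X
    ≡⟨ countB-∷ g x X ⟨
  countB g (x ∷ X) ∎
  where
  open ≡-Reasoning
  g∧≡ᵇ : ℕ → ℕ → Bool
  g∧≡ᵇ r n = g n ∧ (n ≡ᵇ r)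
  x-once : countB (λ r → g x ∧ (x ≡ᵇ r)) U ≡ indicator (g x)
  x-once with g x
  ... | true  = ℕ.≤-antisym (countB≤1 U (λ x≡r → sym (ℕ.≡ᵇ⇒≡ x _ x≡r)) uniq)
                             (1≤countB U x∈U (ℕ.≡⇒≡ᵇ x x refl))
  ... | false = countB≡0 _ U (All.tabulate (λ _ ()))

C[c]+e*C[c+e-1]≡C[c+e] : ∀ c e k → e ℕ.≤ 1 → c C suc k ℕ.+ e ℕ.* (ℕ.pred (c ℕ.+ e) C k) ≡ (c ℕ.+ e) C suc k
C[c]+e*C[c+e-1]≡C[c+e] c zero k _ rewrite ℕ.+-identityʳ c = ℕ.+-identityʳ (c C suc k)
C[c]+e*C[c+e-1]≡C[c+e] c (suc zero) k _ rewrite ℕ.+-comm c 1 | ℕ.+-identityʳ (c C k) =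
  trans (ℕ.+-comm (c C suc k) (c C k)) (nCk+nC[k+1]≡[n+1]C[k+1] c k)
C[c]+e*C[c+e-1]≡C[c+e] c (suc (suc e)) k (s≤s ())

∑C[#X∖r]+k*C[#X]≡#U*C[#X] : ∀ g X U k → All (_∈ U) X → Unique U → Unique X →
  sum (map (λ r → countB (λ n → g n ∧ not (n ≡ᵇ r)) X C k) U) ℕ.+ k ℕ.* (countB g X C k)
    ≡ length U ℕ.* (countB g X C k)
∑C[#X∖r]+k*C[#X]≡#U*C[#X] g X U zero    X⊆U uniqU uniqX = trans (ℕ.+-identityʳ _) (sum-map-const 1 U)
∑C[#X∖r]+k*C[#X]≡#U*C[#X] g X U (suc k) X⊆U uniqU uniqX = begin
  ∑C ℕ.+ suc k ℕ.* (m C suc k)                   ≡⟨ cong (∑C ℕ.+_) (absorb m) ⟨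
  ∑C ℕ.+ m ℕ.* D                                 ≡⟨ cong (λ t → ∑C ℕ.+ t ℕ.* D) (∑countB[≡ᵇr]≡countB g X U X⊆U uniqU) ⟨
  ∑C ℕ.+ sum (map e U) ℕ.* D                     ≡⟨ cong (∑C ℕ.+_) (sum-map-*ʳ e D U) ⟨
  ∑C ℕ.+ sum (map (λ r → e r ℕ.* D) U)           ≡⟨ sum-map-+ (λ r → c r C suc k) (λ r → e r ℕ.* D) U ⟨
  sum (map (λ r → c r C suc k ℕ.+ e r ℕ.* D) U)  ≡⟨ sum-map-cong U (All.tabulate λ {r} _ → remove r) ⟩
  sum (map (λ _ → m C suc k) U)                  ≡⟨ sum-map-const (m C suc k) U ⟩
  length U ℕ.* (m C suc k)                       ∎
  where
  open ≡-Reasoning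
  m = countB g X
  D = ℕ.pred m C k
  c e : ℕ → ℕ
  c r = countB (λ n → g n ∧ not (n ≡ᵇ r)) X
  e r = countB (λ n → g n ∧ (n ≡ᵇ r)) X
  ∑C = sum (map (λ r → c r C suc k) U)
  absorb : ∀ m → m ℕ.* (ℕ.pred m C k) ≡ suc k ℕ.* (m C suc k)
  absorb zero    = sym (ℕ.*-zeroʳ (suc k))
  absorb (suc m) = sym ([1+k]*[1+m]C[1+k]≡[1+m]*mCk m k)
  remove : ∀ r → c r C suc k ℕ.+ e r ℕ.* D ≡ m C suc k
  remove r = subst (λ t → c r C suc k ℕ.+ e r ℕ.* (ℕ.pred t C k) ≡ t C suc k)
    (countB-split g (_≡ᵇ r) X)
    (C[c]+e*C[c+e-1]≡C[c+e] (c r) (e r) k (countB≤1 X (λ n∈r → ℕ.≡ᵇ⇒≡ _ r (proj₂ (Equivalence.to Bool.T-∧ n∈r)) ) uniqX))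

AgreeOutside : List ℕ → Residues → Residues → Set
AgreeOutside ps a b = ∀ q → q ∉ ps → b q ≡ a q

set-≢ : ∀ a p r q → q ≢ p → set a p r q ≡ a q
set-≢ a p r q q≢p with q ≡ᵇ p in q≡ᵇp
... | true  = ⊥-elim (q≢p (ℕ.≡ᵇ⇒≡ q p (subst T (sym q≡ᵇp) _)))
... | false = refl

set-≡ : ∀ a p r → set a p r p ≡ r
set-≡ a p r with p ≡ᵇ p in p≡ᵇp
... | true  = refl
... | false = ⊥-elim (subst T p≡ᵇp (ℕ.≡⇒≡ᵇ p p refl))

Exp-cong : ∀ ps F G a → (∀ b → AgreeOutside ps a b → F b ≡ G b) → Exp ps F a ≡ Exp ps G a
Exp-cong []       F G a F≡G = F≡G a (λ _ _ → refl)
Exp-cong (p ∷ ps) F G a F≡G = cong (λ xs → inv p * sumℚ xs) (List.map-cong (λ r →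
  Exp-cong ps F G (set a p r) λ b b≈a[p↦r] → F≡G b λ q q∉p∷ps →
    trans (b≈a[p↦r] q (q∉p∷ps ∘ there)) (set-≢ a p r q (q∉p∷ps ∘ here))) (upTo p))

sumℚ-map-*toℚ : ∀ A (f : ℕ → ℕ) xs → sumℚ (map (λ x → A * toℚ (f x)) xs) ≡ A * toℚ (sum (map f xs))
sumℚ-map-*toℚ A f []       = sym (*-zeroʳ A)
sumℚ-map-*toℚ A f (x ∷ xs) rewrite sumℚ-map-*toℚ A f xs | toℚ-+ (f x) (sum (map f xs)) =
  sym (*-distribˡ-+ A (toℚ (f x)) (toℚ (sum (map f xs))))

average-over-residues : ∀ p′ k A {s c} → s ℕ.+ k ℕ.* c ≡ suc p′ ℕ.* c →
  inv (suc p′) * (A * toℚ s) ≡ (1ℚ - toℚ k * inv (suc p′)) * A * toℚ c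
average-over-residues p′ k A {s} {c} s+kc≡pc = begin
  x * (A * toℚ s)                             ≡⟨ cong (λ t → x * (A * t)) toℚs≡Pc-Kc ⟩
  x * (A * (P * toℚ c - K * toℚ c))           ≡⟨ expand x A P (toℚ c) K ⟩
  (1ℚ - K * x) * A * toℚ c + A * toℚ c * (x * P - 1ℚ) ≡⟨ cong (λ xP → (1ℚ - K * x) * A * toℚ c + A * toℚ c * (xP - 1ℚ)) (inv*toℚ≡1 p′) ⟩
  (1ℚ - K * x) * A * toℚ c + A * toℚ c * (1ℚ - 1ℚ) ≡⟨ drop ((1ℚ - K * x) * A * toℚ c) (A * toℚ c) ⟩
  (1ℚ - K * x) * A * toℚ c                    ∎
  where
  open ≡-Reasoning
  x = inv (suc p′)
  P = toℚ (suc p′)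
  K = toℚ k
  expand : ∀ x A P c K → x * (A * (P * c - K * c)) ≡ (1ℚ - K * x) * A * c + A * c * (x * P - 1ℚ)
  expand = solve-∀ ℚ-ring
  drop : ∀ e f → e + f * (1ℚ - 1ℚ) ≡ e
  drop = solve-∀ ℚ-ring
  cancel : ∀ s t → s + t - t ≡ s
  cancel = solve-∀ ℚ-ring
  toℚs≡Pc-Kc : toℚ s ≡ P * toℚ c - K * toℚ c
  toℚs≡Pc-Kc = begin
    toℚ s                                ≡⟨ cancel (toℚ s) (K * toℚ c) ⟨
    toℚ s + K * toℚ c - K * toℚ c        ≡⟨ cong (λ t → toℚ s + t - K * toℚ c) (toℚ-* k c) ⟨
    toℚ s + toℚ (k ℕ.* c) - K * toℚ c    ≡⟨ cong (_- K * toℚ c) (toℚ-+ s (k ℕ.* c)) ⟨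
    toℚ (s ℕ.+ k ℕ.* c) - K * toℚ c      ≡⟨ cong (λ t → toℚ t - K * toℚ c) s+kc≡pc ⟩
    toℚ (suc p′ ℕ.* c) - K * toℚ c       ≡⟨ cong (_- K * toℚ c) (toℚ-* (suc p′) c) ⟩
    P * toℚ c - K * toℚ c                ∎

siftBy : Residues → List ℕ → ℕ → Bool
siftBy b ps n = allB (λ p → not (modN n p ≡ᵇ modN (b p) p)) ps

avoiding-residue : ∀ (g : ℕ → Bool) X p′ r → r ℕ.< suc p′ → All (ℕ._< suc p′) X →
  countB (λ n → g n ∧ not (modN n (suc p′) ≡ᵇ modN r (suc p′))) X ≡ countB (λ n → g n ∧ not (n ≡ᵇ r)) X
avoiding-residue g X p′ r r<p X<p =
  countB-cong X (All.map (λ {n} n<p →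
  cong (λ t → g n ∧ not t) (cong₂ _≡ᵇ_ (m<n⇒m%n≡m n<p) (m<n⇒m%n≡m r<p))) X<p)

Exp-binomℚ-sieve : ∀ k ps X (g : ℕ → Bool) a → Unique ps → All (λ p → 0 ℕ.< p × All (ℕ._< p) X) ps → Unique X →
  Exp ps (λ b → binomℚ (countB (λ n → g n ∧ siftBy b ps n) X) k) a ≡ ∏[1-k/p] k ps * binomℚ (countB g X) k
Exp-binomℚ-sieve k [] X g a _ _ _ =
  trans (cong (λ t → binomℚ t k) (countB-cong X (All.tabulate λ {n} _ → Bool.∧-identityʳ (g n))))
        (sym (*-identityˡ _))
Exp-binomℚ-sieve k (zero ∷ ps) X g a _ ((() , _) ∷ _) _
Exp-binomℚ-sieve k (suc p′ ∷ ps) X g a (p∉ps ∷ uniq) ((_ , X<p) ∷ ps-ok) uniqX = begin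
  inv p * sumℚ (map (λ r → Exp ps G (set a p r)) (upTo p))          ≡⟨ cong (λ xs → inv p * sumℚ xs) (List.map-cong-local (All.map (λ {r} → step r) (All.all-upTo p))) ⟩
  inv p * sumℚ (map (λ r → A * toℚ (c r C k)) (upTo p))             ≡⟨ cong (inv p *_) (sumℚ-map-*toℚ A (λ r → c r C k) (upTo p)) ⟩
  inv p * (A * toℚ (sum (map (λ r → c r C k) (upTo p))))             ≡⟨ average-over-residues p′ k A counting ⟩
  (1ℚ - toℚ k * inv p) * A * binomℚ (countB g X) k                  ∎
  where
  open ≡-Reasoning
  p = suc p′
  A = ∏[1-k/p] k ps
  G : Residues → ℚ
  G b = binomℚ (countB (λ n → g n ∧ siftBy b (p ∷ ps) n) X) k
  g[r] : ℕ → ℕ → Bool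
  g[r] r n = g n ∧ not (modN n p ≡ᵇ modN r p)
  c : ℕ → ℕ
  c r = countB (λ n → g n ∧ not (n ≡ᵇ r)) X
  step : ∀ r → r ℕ.< p → Exp ps G (set a p r) ≡ A * toℚ (c r C k)
  step r r<p = begin
    Exp ps G (set a p r)
      ≡⟨ Exp-cong ps G _ (set a p r) (λ b b≈a[p↦r] → cong (λ t → binomℚ t k) (countB-cong X (All.tabulate λ {n} _ →
           trans (cong (λ bp → g n ∧ (not (modN n p ≡ᵇ modN bp p) ∧ siftBy b ps n))
                       (trans (b≈a[p↦r] p (λ p∈ps → All.lookup p∉ps p∈ps refl)) (set-≡ a p r)))
                 (sym (Bool.∧-assoc (g n) _ _))))) ⟩
    Exp ps (λ b → binomℚ (countB (λ n → g[r] r n ∧ siftBy b ps n) X) k) (set a p r)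
      ≡⟨ Exp-binomℚ-sieve k ps X (g[r] r) (set a p r) uniq ps-ok uniqX ⟩
    A * binomℚ (countB (g[r] r) X) k
      ≡⟨ cong (λ t → A * toℚ (t C k)) (avoiding-residue g X p′ r r<p X<p) ⟩
    A * toℚ (c r C k) ∎
  counting : sum (map (λ r → c r C k) (upTo p)) ℕ.+ k ℕ.* (countB g X C k) ≡ p ℕ.* (countB g X C k)
  counting = trans (∑C[#X∖r]+k*C[#X]≡#U*C[#X] g X (upTo p) k (All.map (∈-upTo⁺ {n = p}) X<p) (Unique.upTo⁺ p) uniqX)
                   (cong (ℕ._* (countB g X C k)) (List.length-upTo p))

m≤bound : ∀ {m} q → toℚ m ≤ q → m ℕ.≤ bound q
m≤bound {m} (mkℚ (ℤ.+ N) d _) m≤q rewrite toℚ≡mkℚ m with m≤q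
... | *≤* m*d≤N with subst₂ ℤ._≤_ (sym (ℤ.pos-* m (suc d))) (ℤ.*-identityʳ (ℤ.+ N)) m*d≤N
...   | ℤ.+≤+ m*d≤N′ = ℕ.≤-trans (ℕ.m≤m*n m (suc d)) m*d≤N′
m≤bound {m} (mkℚ ℤ.-[1+ N ] d _) m≤q rewrite toℚ≡mkℚ m with m≤q
... | *≤* m*d≤-N with subst₂ ℤ._≤_ (sym (ℤ.pos-* m (suc d))) refl m*d≤-N
...   | ()

∈natsUpTo⁻ : ∀ {m q} → m ∈ natsUpTo q → toℚ m ≤ q
∈natsUpTo⁻ {m} {q} m∈ = proj₂ (∈-filter⁻ (λ m → toℚ m ≤? q) {xs = upTo (suc (bound q))} m∈)

∈natsUpTo⁺ : ∀ {m q} → toℚ m ≤ q → m ∈ natsUpTo q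
∈natsUpTo⁺ {m} {q} m≤q = ∈-filter⁺ (λ m → toℚ m ≤? q) (∈-upTo⁺ (s≤s (m≤bound q m≤q))) m≤q

natsUpTo-sorted : ∀ q → AllPairs ℕ._<_ (natsUpTo q)
natsUpTo-sorted q = AllPairs.filter⁺ (λ m → toℚ m ≤? q) (AllPairs.applyUpTo⁺₁ (λ i → i) _ (λ i<j _ → i<j))

∈primesUpTo⁻ : ∀ {p w} → p ∈ primesUpTo w → Prime p × toℚ p ≤ w
∈primesUpTo⁻ p∈ with ∈-filter⁻ prime? p∈
... | p∈nats , p-prime = p-prime , ∈natsUpTo⁻ p∈nats

∈primesUpTo⁺ : ∀ {p w} → Prime p → toℚ p ≤ w → p ∈ primesUpTo w
∈primesUpTo⁺ p-prime p≤w = ∈-filter⁺ prime? (∈natsUpTo⁺ p≤w) p-prime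

∈primesIn⁻ : ∀ {p w z} → p ∈ primesIn w z → p ∈ primesUpTo z × w < toℚ p
∈primesIn⁻ {w = w} p∈ = ∈-filter⁻ (λ p → w <? toℚ p) p∈

∈primesIn⁺ : ∀ {p w z} → p ∈ primesUpTo z → w < toℚ p → p ∈ primesIn w z
∈primesIn⁺ {w = w} p∈ w<p = ∈-filter⁺ (λ p → w <? toℚ p) p∈ w<p

primesIn-sorted : ∀ w z → AllPairs ℕ._<_ (primesIn w z)
primesIn-sorted w z = AllPairs.filter⁺ (λ p → w <? toℚ p) (AllPairs.filter⁺ prime? (natsUpTo-sorted z))

sorted⇒unique : ∀ {xs} → AllPairs ℕ._<_ xs → Unique xs
sorted⇒unique = AllPairs.map ℕ.<⇒≢

T-allB⁻ : ∀ f xs → T (allB f xs) → All (T ∘ f) xs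
T-allB⁻ f []       _   = []
T-allB⁻ f (x ∷ xs) fxs with Equivalence.to Bool.T-∧ fxs
... | fx , fxs′ = fx ∷ T-allB⁻ f xs fxs′

T-allB⁺ : ∀ f xs → All (T ∘ f) xs → T (allB f xs)
T-allB⁺ f []       []         = _
T-allB⁺ f (x ∷ xs) (fx ∷ fxs) = Equivalence.from Bool.T-∧ (fx , T-allB⁺ f xs fxs)

T-⇔⇒≡ : ∀ {u v} → (T u → T v) → (T v → T u) → u ≡ v
T-⇔⇒≡ {true}  {true}  _ _ = refl
T-⇔⇒≡ {true}  {false} u⇒v _ = ⊥-elim (u⇒v _)
T-⇔⇒≡ {false} {true}  _ v⇒u = ⊥-elim (v⇒u _)
T-⇔⇒≡ {false} {false} _ _ = refl

allB-cover : ∀ (f g : ℕ → Bool) xs ys zs → All (λ x → f x ≡ g x) xs →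
  xs ⊆ zs → ys ⊆ zs → (∀ {q} → q ∈ zs → q ∈ xs ⊎ q ∈ ys) →
  allB g zs ≡ allB f xs ∧ allB g ys
allB-cover f g xs ys zs f≡g xs⊆zs ys⊆zs cover = T-⇔⇒≡
  (λ gzs → let gzs′ = T-allB⁻ g zs gzs in Equivalence.from Bool.T-∧
    ( T-allB⁺ f xs (All.tabulate λ q∈xs → subst T (sym (All.lookup f≡g q∈xs)) (All.lookup gzs′ (xs⊆zs q∈xs)))
    , T-allB⁺ g ys (All.tabulate λ q∈ys → All.lookup gzs′ (ys⊆zs q∈ys))))
  (λ fxs∧gys → let (fxs , gys) = Equivalence.to Bool.T-∧ fxs∧gys in T-allB⁺ g zs (All.tabulate λ q∈zs →
    [ (λ q∈xs → subst T (All.lookup f≡g q∈xs) (All.lookup (T-allB⁻ f xs fxs) q∈xs))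
    , All.lookup (T-allB⁻ g ys gys) ]′ (cover q∈zs)))

sifted-split : ∀ {w z} a b → w ≤ z → AgreeOutside (primesIn w z) a b → ∀ n →
  sifted z b n ≡ sifted w a n ∧ siftBy b (primesIn w z) n
sifted-split {w} {z} a b w≤z b≈a n = allB-cover
  (λ p → not (modN n p ≡ᵇ modN (a p) p)) (λ p → not (modN n p ≡ᵇ modN (b p) p))
  (primesUpTo w) (primesIn w z) (primesUpTo z)
  (All.tabulate λ {q} q∈ → cong (λ r → not (modN n q ≡ᵇ modN r q)) (sym (b≈a q (small∉primesIn q∈))))
  (λ q∈ → let (q-prime , q≤w) = ∈primesUpTo⁻ {w = w} q∈ in ∈primesUpTo⁺ {w = z} q-prime (≤-trans q≤w w≤z))
  (λ q∈ → proj₁ (∈primesIn⁻ {w = w} {z} q∈))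
  (λ {q} q∈ → case-≤ q∈ (toℚ q ≤? w))
  where
  small∉primesIn : ∀ {q} → q ∈ primesUpTo w → q ∉ primesIn w z
  small∉primesIn q∈ q∈′ = <-irrefl refl (<-≤-trans (proj₂ (∈primesIn⁻ {w = w} {z} q∈′)) (proj₂ (∈primesUpTo⁻ {w = w} q∈)))
  case-≤ : ∀ {q} → q ∈ primesUpTo z → Dec (toℚ q ≤ w) → q ∈ primesUpTo w ⊎ q ∈ primesIn w z
  case-≤ q∈ (yes q≤w) = inj₁ (∈primesUpTo⁺ (proj₁ (∈primesUpTo⁻ {w = z} q∈)) q≤w)
  case-≤ q∈ (no  q≰w) = inj₂ (∈primesIn⁺ {w = w} {z} q∈ (≰⇒> q≰w))

2ℚ : ℚ
2ℚ = 1ℚ + 1ℚ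

8ℚ : ℚ
8ℚ = 2ℚ * 2ℚ * 2ℚ

sorted-length-bound : ∀ y xs c → AllPairs ℕ._<_ xs → All (c ℕ.≤_) xs → All (λ m → toℚ m ≤ y) xs →
  toℚ c ≤ y + 1ℚ → toℚ (length xs ℕ.+ c) ≤ y + 1ℚ
sorted-length-bound y []       c _ _ _ c≤y+1 = c≤y+1
sorted-length-bound y (x ∷ xs) c (x<xs ∷ sorted) (c≤x ∷ _) (x≤y ∷ xs≤y) _ =
  ≤-trans (toℚ-mono-≤ (ℕ.≤-trans (ℕ.≤-reflexive (sym (ℕ.+-suc (length xs) c))) (ℕ.+-monoʳ-≤ (length xs) (s≤s c≤x))))
          (sorted-length-bound y xs (suc x) sorted x<xs xs≤y 1+x≤y+1)
  where
  1+x≤y+1 : toℚ (suc x) ≤ y + 1ℚ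
  1+x≤y+1 = subst₂ _≤_ (trans (+-comm (toℚ x) 1ℚ) (sym (toℚ-suc x))) refl (+-monoˡ-≤ 1ℚ x≤y)

S≤y+1 : ∀ {y} w a → 0ℚ ≤ y → toℚ (S y w a) ≤ y + 1ℚ
S≤y+1 {y} w a 0≤y = ≤-trans (toℚ-mono-≤ (countB≤length (sifted w a) (natsUpTo y)))
  (subst (_≤ y + 1ℚ) (cong toℚ (ℕ.+-identityʳ (length (natsUpTo y))))
    (sorted-length-bound y (natsUpTo y) 0 (natsUpTo-sorted y) (All.tabulate (λ _ → z≤n)) (All.tabulate ∈natsUpTo⁻)
      (+-pres-0≤ 0≤y (nonNegative⁻¹ 1ℚ))))

∣L*B-P*B∣≡[P-L]*B : ∀ {L P B} → L ≤ P → 0ℚ ≤ B → ∣ L * B - P * B ∣ ≡ (P - L) * B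
∣L*B-P*B∣≡[P-L]*B {L} {P} {B} L≤P 0≤B = begin
  ∣ L * B - P * B ∣       ≡⟨ ∣-p∣≡∣p∣ (L * B - P * B) ⟨
  ∣ - (L * B - P * B) ∣   ≡⟨ cong ∣_∣ (negate L B P) ⟩
  ∣ (P - L) * B ∣         ≡⟨ 0≤p⇒∣p∣≡p (*-pres-0≤ (p≤q⇒0≤q-p L≤P) 0≤B) ⟩
  (P - L) * B             ∎
  where
  open ≡-Reasoning
  negate : ∀ L B P → - (L * B - P * B) ≡ (P - L) * B
  negate = solve-∀ ℚ-ring

relative-error-bound : ∀ {L P B K s y w} → 0ℚ ≤ B → 0ℚ ≤ P → 0ℚ ≤ w → L ≤ P →
  P * (1ℚ - K * K * s) ≤ L → K * K * s * w ≤ 8ℚ * (y * y) →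
  ∣ L * B - P * B ∣ * w ≤ 8ℚ * (P * B) * (y * y)
relative-error-bound {L} {P} {B} {K} {s} {y} {w} 0≤B 0≤P 0≤w L≤P lower Ksw≤8y² =
  subst (λ e → e * w ≤ 8ℚ * (P * B) * (y * y)) (sym (∣L*B-P*B∣≡[P-L]*B L≤P 0≤B))
    (≤-by-difference _ (gap L P B K s y w 8ℚ)
      (+-pres-0≤ (*-pres-0≤ (*-pres-0≤ 0≤B 0≤w) (p≤q⇒0≤q-p lower))
                 (*-pres-0≤ (*-pres-0≤ 0≤P 0≤B) (p≤q⇒0≤q-p Ksw≤8y²))))
  where
  gap : ∀ L P B K s y w c → c * (P * B) * (y * y) - (P - L) * B * w
      ≡ B * w * (L - P * (1ℚ - K * K * s)) + P * B * (c * (y * y) - K * K * s * w)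
  gap = solve-∀ ℚ-ring

relative-error-of-zero : ∀ L P y w → ∣ L * 0ℚ - P * 0ℚ ∣ * w ≤ 8ℚ * (P * 0ℚ) * (y * y)
relative-error-of-zero L P y w = ≤-reflexive (begin
  ∣ L * 0ℚ - P * 0ℚ ∣ * w    ≡⟨ cong (λ t → ∣ t ∣ * w) (L*0-P*0≡0 L P) ⟩
  0ℚ * w                    ≡⟨ *-zeroˡ w ⟩
  0ℚ                        ≡⟨ c*[P*0]*y²≡0 8ℚ P y ⟨
  8ℚ * (P * 0ℚ) * (y * y)   ∎)
  where
  open ≡-Reasoning
  L*0-P*0≡0 : ∀ L P → L * 0ℚ - P * 0ℚ ≡ 0ℚ
  L*0-P*0≡0 = solve-∀ ℚ-ring
  c*[P*0]*y²≡0 : ∀ c P y → c * (P * 0ℚ) * (y * y) ≡ 0ℚ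
  c*[P*0]*y²≡0 = solve-∀ ℚ-ring

-- sw ≤ 2 as w ≥ 2, and K² ≤ (y + 1)² ≤ 4y²: this is where the constant 8 comes from.
K²sw≤8y² : ∀ {K s y w} → 0ℚ ≤ K → K ≤ y + 1ℚ → 1ℚ ≤ y → 0ℚ ≤ s → s * (w - 1ℚ) ≤ 1ℚ → 2ℚ ≤ w →
  K * K * s * w ≤ 8ℚ * (y * y)
K²sw≤8y² {K} {s} {y} {w} 0≤K K≤y+1 1≤y 0≤s s[w-1]≤1 2≤w = ≤-by-difference _ (gap K s y w)
  (+-pres-0≤ (*-pres-0≤ (*-pres-0≤ 0≤K 0≤K) (+-pres-0≤ (*-pres-0≤ 0≤2 (p≤q⇒0≤q-p s[w-1]≤1)) (*-pres-0≤ 0≤s (p≤q⇒0≤q-p 2≤w))))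
             (*-pres-0≤ 0≤2 (*-pres-0≤ (+-pres-0≤ (p≤q⇒0≤q-p 1≤y) (p≤q⇒0≤q-p K≤y+1))
                                        (+-pres-0≤ (*-pres-0≤ 0≤2 (≤-trans (nonNegative⁻¹ 1ℚ) 1≤y)) 0≤K))))
  where
  0≤2 : 0ℚ ≤ 2ℚ
  0≤2 = nonNegative⁻¹ 2ℚ
  gap : ∀ K s y w → 8ℚ * (y * y) - K * K * s * w
      ≡ K * K * (2ℚ * (1ℚ - s * (w - 1ℚ)) + s * (w - 2ℚ)) + 2ℚ * ((y - 1ℚ + (y + 1ℚ - K)) * (2ℚ * y + K))
  gap = solve-∀ ℚ-ring

y+1≤y⁴ : ∀ {y} → 2ℚ ≤ y → y + 1ℚ ≤ y * y * y * y
y+1≤y⁴ {y} 2≤y = ≤-by-difference _ (gap y)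
  (+-pres-0≤ (*-pres-0≤ (p≤q⇒0≤q-p 2≤y) (+-pres-0≤ (+-pres-0≤ (+-pres-0≤ 0≤y³ 0≤y²) 0≤y) (nonNegative⁻¹ 1ℚ)))
             (+-pres-0≤ (+-pres-0≤ 0≤y³ 0≤y²) (nonNegative⁻¹ 1ℚ)))
  where
  0≤y = ≤-trans (nonNegative⁻¹ 2ℚ) 2≤y
  0≤y² = *-pres-0≤ 0≤y 0≤y
  0≤y³ = *-pres-0≤ 0≤y² 0≤y
  gap : ∀ y → y * y * y * y - (y + 1ℚ)
      ≡ (y - 2ℚ) * (y * y * y + y * y + y + 1ℚ) + (y * y * y + y * y + 1ℚ)
  gap = solve-∀ ℚ-ring

module _ {y w z : ℚ} (2≤y : 2ℚ ≤ y) (y⁴≤w : y * y * y * y ≤ w) (w²≤z : w * w ≤ z) where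

  1≤y : 1ℚ ≤ y
  1≤y = ≤-trans (p≤p+q 1ℚ (nonNegative⁻¹ 1ℚ)) 2≤y

  0≤y : 0ℚ ≤ y
  0≤y = ≤-trans (nonNegative⁻¹ 1ℚ) 1≤y

  y+1≤w : y + 1ℚ ≤ w
  y+1≤w = ≤-trans (y+1≤y⁴ 2≤y) y⁴≤w

  y<w : y < w
  y<w = <-≤-trans (subst (_< y + 1ℚ) (+-identityʳ y) (+-monoʳ-< y (positive⁻¹ 1ℚ))) y+1≤w

  2≤w : 2ℚ ≤ w
  2≤w = ≤-trans 2≤y (<⇒≤ y<w)

  0≤w-1 : 0ℚ ≤ w - 1ℚ
  0≤w-1 = p≤q⇒0≤q-p (≤-trans 1≤y (<⇒≤ y<w))

  0≤w : 0ℚ ≤ w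
  0≤w = ≤-trans 0≤y (<⇒≤ y<w)

  w≤z : w ≤ z
  w≤z = ≤-trans (≤-by-difference _ (w²-w w) (*-pres-0≤ 0≤w 0≤w-1)) w²≤z
    where
    w²-w : ∀ w → w * w - w ≡ w * (w - 1ℚ)
    w²-w = solve-∀ ℚ-ring

  w<p : ∀ {p} → p ∈ primesIn w z → w < toℚ p
  w<p {p} p∈ = proj₂ (∈primesIn⁻ {p} {w} {z} p∈)

  primesIn-large : All (λ p → 0 ℕ.< p × All (ℕ._< p) (natsUpTo y)) (primesIn w z)
  primesIn-large = All.tabulate λ {p} p∈ →
    ℕ.>-nonZero⁻¹ p {{prime⇒nonZero (proj₁ (∈primesUpTo⁻ {p} {z} (proj₁ (∈primesIn⁻ {p} {w} {z} p∈))))}} ,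
    All.tabulate λ m∈ → toℚ-cancel-< (≤-<-trans (∈natsUpTo⁻ m∈) (<-trans y<w (w<p p∈)))

  Exp-binomℚ-S : ∀ a k → Exp (primesIn w z) (λ b → binomℚ (S y z b) k) a ≡ ∏[1-k/p] k (primesIn w z) * binomℚ (S y w a) k
  Exp-binomℚ-S a k = trans
    (Exp-cong (primesIn w z) _ _ a λ b b≈a → cong (λ t → binomℚ t k)
      (countB-cong (natsUpTo y) (All.tabulate λ {n} _ → sifted-split a b w≤z b≈a n)))
    (Exp-binomℚ-sieve k (primesIn w z) (natsUpTo y) (sifted w a) a
      (sorted⇒unique (primesIn-sorted w z)) primesIn-large (sorted⇒unique (natsUpTo-sorted y)))

  ∑[1/p²]*[w-1]≤1 : ∑[1/p²] (primesIn w z) * (w - 1ℚ) ≤ 1ℚ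
  ∑[1/p²]*[w-1]≤1 = ∑[1/p²]*t≤1 (w - 1ℚ) (primesIn w z) 0≤w-1 (primesIn-sorted w z)
    (All.tabulate λ p∈ → subst (_≤ _) (1+[w-1]≡w w) (<⇒≤ (w<p p∈)))
    where
    1+[w-1]≡w : ∀ w → w ≡ 1ℚ + (w - 1ℚ)
    1+[w-1]≡w = solve-∀ ℚ-ring

  k≤y+1 : ∀ a k → k ℕ.≤ S y w a → toℚ k ≤ y + 1ℚ
  k≤y+1 a k k≤S = ≤-trans (toℚ-mono-≤ k≤S) (S≤y+1 w a 0≤y)

  k≤primesIn : ∀ a k → k ℕ.≤ S y w a → All (k ℕ.≤_) (primesIn w z)
  k≤primesIn a k k≤S = All.tabulate λ p∈ → ℕ.<⇒≤ (toℚ-cancel-< (≤-<-trans (≤-trans (k≤y+1 a k k≤S) y+1≤w) (w<p p∈)))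

  ∏-relative-error : ∀ a k → Dec (k ℕ.≤ S y w a) →
    ∣ ∏[1-k/p] k (primesIn w z) * binomℚ (S y w a) k - ∏[1-1/p]^k k (primesIn w z) * binomℚ (S y w a) k ∣ * w
      ≤ 8ℚ * (∏[1-1/p]^k k (primesIn w z) * binomℚ (S y w a) k) * (y * y)
  -- The implicit arguments are given: inferring them makes Agda normalise rational arithmetic.
  ∏-relative-error a k (yes k≤S) =
    relative-error-bound {L} {P} {B} {toℚ k} {s} {y} {w} (0≤toℚ (S y w a C k)) (0≤∏[1-1/p]^k k ps) 0≤w
      (∏[1-k/p]≤∏[1-1/p]^k k ps (k≤primesIn a k k≤S)) (∏[1-1/p]^k*[1-k²∑1/p²]≤∏[1-k/p] k ps (k≤primesIn a k k≤S))
      (K²sw≤8y² {toℚ k} {s} {y} {w} (0≤toℚ k) (k≤y+1 a k k≤S) 1≤y (0≤∑[1/p²] ps) ∑[1/p²]*[w-1]≤1 2≤w)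
    where
    ps = primesIn w z
    L = ∏[1-k/p] k ps
    P = ∏[1-1/p]^k k ps
    B = binomℚ (S y w a) k
    s = ∑[1/p²] ps
  ∏-relative-error a k (no k≰S) =
    subst (λ B → ∣ L * B - P * B ∣ * w ≤ 8ℚ * (P * B) * (y * y))
      (cong toℚ (sym (k>n⇒nCk≡0 (ℕ.≰⇒> k≰S))))
      (relative-error-of-zero L P y w)
    where
    L = ∏[1-k/p] k (primesIn w z)
    P = ∏[1-1/p]^k k (primesIn w z)

corollary6p4 :
    Σ ℚ λ C → Σ ℚ λ Y₀ →
      (y w z : ℚ) → Y₀ ≤ y → y * y * y * y ≤ w → w * w ≤ z →
      (a : Residues) (k : ℕ) →
        ∣ Exp (primesIn w z) (λ b → binomℚ (S y z b) k) a
            - powℚ (Θ w z) k * binomℚ (S y w a) k ∣ * w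
          ≤ C * (powℚ (Θ w z) k * binomℚ (S y w a) k) * (y * y)
corollary6p4 = 8ℚ , 2ℚ , λ y w z 2≤y y⁴≤w w²≤z a k →
  subst₂ (λ E Θᵏ → ∣ E - Θᵏ * binomℚ (S y w a) k ∣ * w ≤ 8ℚ * (Θᵏ * binomℚ (S y w a) k) * (y * y))
    (sym (Exp-binomℚ-S 2≤y y⁴≤w w²≤z a k))
    (sym (powℚ-prodℚ (λ p → 1ℚ - inv p) (primesIn w z) k))
    (∏-relative-error 2≤y y⁴≤w w²≤z a k (k ℕ.≤? S y w a))
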